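{- For all $m\ge n\ge 2$, let $Comb_m\in RB_U(m)$ be the $m$-leaf comb tree. Then $\pi_n(p_{Comb_m})$ is a vertex of the polytope $EX_n^m$.
   Context: For $k\ge 2$, $RB_L(k)$ denotes the set of rooted binary trees (every non-leaf vertex has exactly two unordered children) with $k$ leaves labelled bijectively by $[k]$, up to label-preserving isomorphism, and $RB_U(k)$ the set of unlabelled tree shapes with $k$ leaves. The comb tree $Comb_k\in RB_U(k)$ is the unique shape in which every non-leaf vertex has at least one leaf child. For $T\in RB_U(k)$, $p_T$ is the distribution on $RB_L(k)$ that is uniform on the labelled trees of shape $T$ and zero elsewhere. For a rooted binary tree $Q$ and a set $A$ of its leaves, $Q|_A$ is the restriction tree (vertices: elements of $A$ and lowest common ancestors of pairs of them, ancestry inherited from $Q$). A distribution on $RB_L(k)$ is exchangeable if invariant under permutations of the leaf labels; $EX_k$ is the set of exchangeable distributions. For a distribution $p_m$ on $RB_L(m)$, $\pi_n(p_m)(S)=\sum_{\{Q\in RB_L(m): Q|_{[n]}=S\}}p_m(Q)$, and $EX_n^m=\pi_n(EX_m)\subseteq\mathbb{R}^{RB_L(n)}$, which is a polytope (the convex hull of the points $\pi_n(p_T)$, $T\in RB_U(m)$).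
   Formalization: Distributions take rational values, so points of $EX_n^m$ have rational coordinates, and the convex combinations in the vertex condition use rational coefficients and rational points of $EX_n^m$. -}

module Defs where

open import Data.Bool using (Bool; true; false; _∧_; _∨_; if_then_else_)
open import Data.Nat using (ℕ; _<?_)
open import Data.Fin using (Fin; toℕ; fromℕ<)
import Data.Fin as Fin
open import Data.Fin.Permutation using (Permutation′; _⟨$⟩ʳ_)
open import Data.List using (List; []; _∷_; _++_; allFin)
open import Data.List.Relation.Unary.All using (All)
open import Data.List.Relation.Binary.Permutation.Propositional using (_↭_)
open import Data.Maybe using (Maybe; just; nothing)
open import Data.Product using (_×_; _,_; proj₁; proj₂; Σ; ∃)
open import Data.Sum using (_⊎_)
open import Data.Unit using (⊤)
open import Data.Empty using (⊥)
open import Data.Rational using (ℚ; 0ℚ; 1ℚ; _+_; _*_; _-_; _<_; _≤_)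
open import Relation.Nullary using (¬_; yes; no)
open import Relation.Nullary.Decidable using (⌊_⌋)
open import Relation.Binary.PropositionalEquality using (_≡_)

-- Plane binary trees with leaves labelled in A.  A rooted binary tree
-- (children unordered) is a plane tree up to swapping children, see `iso`.

data Tree (A : Set) : Set where
  leaf : A → Tree A
  node : Tree A → Tree A → Tree A

leaves : ∀ {A} → Tree A → List A
leaves (leaf a)   = a ∷ []
leaves (node s t) = leaves s ++ leaves t

map : ∀ {A B : Set} → (A → B) → Tree A → Tree B
map f (leaf a)   = leaf (f a)
map f (node s t) = node (map f s) (map f t)

iso : ∀ {k} → Tree (Fin k) → Tree (Fin k) → Bool
iso (leaf a)   (leaf b)     = ⌊ a Fin.≟ b ⌋
iso (node s t) (node s' t') = (iso s s' ∧ iso t t') ∨ (iso s t' ∧ iso t s')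
iso _          _            = false

-- leaves labelled bijectively by [k] (we use labels 0,…,k-1)
IsLabelled : (k : ℕ) → Tree (Fin k) → Set
IsLabelled k t = leaves t ↭ allFin k

-- RB_L(k) is represented by the plane trees t with IsLabelled k t,
-- considered up to `iso`.

IsLeaf : ∀ {A} → Tree A → Set
IsLeaf (leaf _)   = ⊤
IsLeaf (node _ _) = ⊥

IsComb : ∀ {A} → Tree A → Set
IsComb (leaf _)   = ⊤
IsComb (node s t) = (IsLeaf s ⊎ IsLeaf t) × IsComb s × IsComb t

-- Distributions on RB_L(k), as finite lists of weighted labelled trees.

sumW : ∀ {A : Set} → List (A × ℚ) → ℚ
sumW []             = 0ℚ
sumW ((_ , w) ∷ xs) = w + sumW xs

record Dist (k : ℕ) : Set where
  field
    entries   : List (Tree (Fin k) × ℚ)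
    labelled  : All (λ e → IsLabelled k (proj₁ e)) entries
    nonneg    : All (λ e → 0ℚ ≤ proj₂ e) entries
    total     : sumW entries ≡ 1ℚ
open Dist public

massL : ∀ {k} → List (Tree (Fin k) × ℚ) → Tree (Fin k) → ℚ
massL []             Q = 0ℚ
massL ((t , w) ∷ xs) Q = (if iso t Q then w else 0ℚ) + massL xs Q

mass : ∀ {k} → Dist k → Tree (Fin k) → ℚ
mass d Q = massL (entries d) Q

Exchangeable : ∀ {k} → Dist k → Set
Exchangeable {k} d =
  (σ : Permutation′ k) (Q : Tree (Fin k)) → mass d (map (σ ⟨$⟩ʳ_) Q) ≡ mass d Q

-- p is p_{Comb_k}: uniform on labelled trees of comb shape, zero elsewhere
IsCombUniform : ∀ {k} → Dist k → Set
IsCombUniform {k} d =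
  ((Q : Tree (Fin k)) → IsLabelled k Q → ¬ IsComb Q → mass d Q ≡ 0ℚ) ×
  ((Q Q' : Tree (Fin k)) → IsLabelled k Q → IsComb Q →
     IsLabelled k Q' → IsComb Q' → mass d Q ≡ mass d Q')

-- Restriction Q|_[n] (suppressing the resulting degree-two vertices),
-- relabelled into Fin n.

lowerLabel : ∀ {m} (n : ℕ) → Fin m → Maybe (Fin n)
lowerLabel n a with toℕ a <? n
... | yes p = just (fromℕ< p)
... | no _  = nothing

restrict : ∀ {m} (n : ℕ) → Tree (Fin m) → Maybe (Tree (Fin n))
restrict n (leaf a) with lowerLabel n a
... | just b  = just (leaf b)
... | nothing = nothing
restrict n (node s t) with restrict n s | restrict n t
... | just s' | just t' = just (node s' t')
... | just s' | nothing = just s'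
... | nothing | just t' = just t'
... | nothing | nothing = nothing

piL : ∀ {m} (n : ℕ) → List (Tree (Fin m) × ℚ) → Tree (Fin n) → ℚ
piL n []             S = 0ℚ
piL n ((t , w) ∷ xs) S with restrict n t
... | just t' = (if iso t' S then w else 0ℚ) + piL n xs S
... | nothing = piL n xs S

π : ∀ {m} (n : ℕ) → Dist m → Tree (Fin n) → ℚ
π n d = piL n (entries d)

-- The set EX_n^m = π_n(EX_m), points being functions on RB_L(n).

InEX : (n m : ℕ) → (Tree (Fin n) → ℚ) → Set
InEX n m x = Σ (Dist m) λ d → Exchangeable d ×
  ((S : Tree (Fin n)) → IsLabelled n S → x S ≡ π n d S)

IsVertexEX : (n m : ℕ) → (Tree (Fin n) → ℚ) → Set
IsVertexEX n m v =
  InEX n m v ×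
  ((x y : Tree (Fin n) → ℚ) (λ' : ℚ) → InEX n m x → InEX n m y →
    0ℚ < λ' → λ' < 1ℚ →
    ((S : Tree (Fin n)) → IsLabelled n S → v S ≡ λ' * x S + (1ℚ - λ') * y S) →
    (S : Tree (Fin n)) → IsLabelled n S → x S ≡ v S)

-- Write v = π_n(p_Comb_m).  The restriction of a comb is a comb, so v vanishes off combs.  If
-- v = λ x + (1 - λ) y with 0 < λ < 1 and x = π_n(q₁), y = π_n(q₂) for exchangeable q₁, q₂,
-- then x, y ≥ 0 force x to vanish off combs too.  For exchangeable q, π_n(q) is invariant under
-- transpositions of labels and all labelled combs lie in one orbit, so π_n(q) is constant on
-- labelled combs.  Let A(q, q′) be the probability that independent samples of q and q′ have
-- isomorphic restrictions to [n].  A is symmetric, and when π_n(q) vanishes off combs A(q, q′)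
-- is the value of π_n(q′) on combs.  So x(S) = A(p_Comb_m, q₁) = A(q₁, p_Comb_m) = v(S) for
-- every labelled comb S, while x = v = 0 off combs.

module Submission where

open import Defs
open import Data.Bool using (Bool; true; false; T; not; if_then_else_)
open import Data.Bool.Properties using (T-∧; T-∨; T-≡; ⇔→≡)
open import Data.Empty using (⊥-elim)
open import Data.Fin using (Fin; zero; suc; toℕ; inject≤)
import Data.Fin as Fin
import Data.Fin.Properties as Fin
open import Data.Fin.Permutation using (Permutation′; _⟨$⟩ʳ_; _⟨$⟩ˡ_; inverseˡ; inverseʳ)
import Data.Fin.Permutation as Perm
open import Data.Fin.Permutation.Components using (transpose)
open import Data.List using (List; []; _∷_; _++_; length; filterᵇ; allFin; mapMaybe)
import Data.List as List
import Data.List.Properties as List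
open import Data.List.Membership.Propositional using (_∈_; _∉_)
open import Data.List.Membership.Propositional.Properties using (∈-allFin; ∈-map⁺)
open import Data.List.Membership.Propositional.Properties.WithK using (unique∧set⇒bag)
open import Data.List.Relation.Binary.BagAndSetEquality using (∼bag⇒↭)
open import Data.List.Relation.Binary.Permutation.Propositional
  using (_↭_; ↭-refl; ↭-sym; ↭-trans; ↭⇒↭ₛ)
import Data.List.Relation.Binary.Permutation.Propositional as PR
import Data.List.Relation.Binary.Permutation.Propositional.Properties as ↭
import Data.List.Relation.Binary.Permutation.Setoid.Properties as ↭ₛ
open import Data.List.Relation.Unary.All using (All; []; _∷_)
import Data.List.Relation.Unary.All as All
open import Data.List.Relation.Unary.All.Properties using (All¬⇒¬Any)
open import Data.List.Relation.Unary.AllPairs using (_∷_)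
open import Data.List.Relation.Unary.Any using (Any; here; there)
open import Data.List.Relation.Unary.Unique.Propositional using (Unique)
import Data.List.Relation.Unary.Unique.Propositional.Properties as Unique
open import Data.Maybe using (Maybe; just; nothing)
import Data.Maybe as Maybe
import Data.Maybe.Properties as Maybe
open import Data.Maybe.Relation.Binary.Pointwise as Pointwise using (Pointwise; just; nothing)
open import Data.Maybe.Relation.Unary.All as MaybeAll using (just; nothing)
open import Data.Nat as ℕ using (ℕ; zero; suc; z≤n; s≤s; _≤_)
import Data.Nat.Properties as ℕₚ
open import Data.Product using (_×_; _,_; proj₁; proj₂; Σ; ∃₂)
import Data.Product as Product
open import Data.Rational as ℚ using (ℚ; 0ℚ; 1ℚ; _+_; _*_; _-_; -_; nonNegative; positive)
import Data.Rational.Properties as ℚₚ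
open import Data.Rational.Solver using (module +-*-Solver)
open import Data.Sum using (_⊎_; inj₁; inj₂)
open import Data.Unit using (tt)
open import Function using (id; _∘_; Equivalence; mk⇔)
open import Relation.Nullary using (Dec; yes; no; ¬_)
open import Relation.Nullary.Decidable
  using (_×-dec_; _⊎-dec_; toWitness; fromWitness; dec-true; dec-false)
open import Relation.Binary.PropositionalEquality
  using (_≡_; _≢_; refl; sym; trans; cong; cong₂; subst; subst₂; setoid; module ≡-Reasoning)

open Equivalence using (to; from)
open ≡-Reasoning

-- Isomorphism of trees

infix 4 _≅_

data _≅_ {A : Set} : Tree A → Tree A → Set where
  leaf : ∀ {a} → leaf a ≅ leaf a
  node : ∀ {s t s′ t′} → s ≅ s′ → t ≅ t′ → node s t ≅ node s′ t′
  swap : ∀ {s t s′ t′} → s ≅ t′ → t ≅ s′ → node s t ≅ node s′ t′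

module _ {A : Set} where

  ≅-refl : (t : Tree A) → t ≅ t
  ≅-refl (leaf a)   = leaf
  ≅-refl (node s t) = node (≅-refl s) (≅-refl t)

  ≅-sym : ∀ {s t : Tree A} → s ≅ t → t ≅ s
  ≅-sym leaf       = leaf
  ≅-sym (node p q) = node (≅-sym p) (≅-sym q)
  ≅-sym (swap p q) = swap (≅-sym q) (≅-sym p)

  ≅-trans : ∀ {s t u : Tree A} → s ≅ t → t ≅ u → s ≅ u
  ≅-trans leaf       leaf         = leaf
  ≅-trans (node p q) (node p′ q′) = node (≅-trans p p′) (≅-trans q q′)
  ≅-trans (node p q) (swap p′ q′) = swap (≅-trans p p′) (≅-trans q q′)
  ≅-trans (swap p q) (node p′ q′) = swap (≅-trans p q′) (≅-trans q p′)
  ≅-trans (swap p q) (swap p′ q′) = node (≅-trans p q′) (≅-trans q p′)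

  ≅-leaves : ∀ {s t : Tree A} → s ≅ t → leaves s ↭ leaves t
  ≅-leaves leaf       = ↭-refl
  ≅-leaves (node p q) = ↭.++⁺ (≅-leaves p) (≅-leaves q)
  ≅-leaves (swap {s′ = s′} {t′} p q) =
    ↭-trans (↭.++⁺ (≅-leaves p) (≅-leaves q)) (↭.++-comm (leaves t′) (leaves s′))

  ≅-isLeaf : ∀ {s t : Tree A} → s ≅ t → IsLeaf s → IsLeaf t
  ≅-isLeaf leaf _ = tt

  ≅-isComb : ∀ {s t : Tree A} → s ≅ t → IsComb s → IsComb t
  ≅-isComb leaf       _                  = tt
  ≅-isComb (node p q) (inj₁ l , cs , ct) = inj₁ (≅-isLeaf p l) , ≅-isComb p cs , ≅-isComb q ct
  ≅-isComb (node p q) (inj₂ l , cs , ct) = inj₂ (≅-isLeaf q l) , ≅-isComb p cs , ≅-isComb q ct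
  ≅-isComb (swap p q) (inj₁ l , cs , ct) = inj₂ (≅-isLeaf p l) , ≅-isComb q ct , ≅-isComb p cs
  ≅-isComb (swap p q) (inj₂ l , cs , ct) = inj₁ (≅-isLeaf q l) , ≅-isComb q ct , ≅-isComb p cs

map-≅ : ∀ {A B : Set} (f : A → B) {s t : Tree A} → s ≅ t → map f s ≅ map f t
map-≅ f leaf       = leaf
map-≅ f (node p q) = node (map-≅ f p) (map-≅ f q)
map-≅ f (swap p q) = swap (map-≅ f p) (map-≅ f q)

T-ext : ∀ {a b : Bool} → (T a → T b) → (T b → T a) → a ≡ b
T-ext f g = ⇔→≡ {z = true} (mk⇔ (T-≡ .to ∘ f ∘ T-≡ .from) (T-≡ .to ∘ g ∘ T-≡ .from))

module _ {k : ℕ} where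

  iso⇒≅ : (s t : Tree (Fin k)) → T (iso s t) → s ≅ t
  iso⇒≅ (leaf a)   (leaf b)     e with refl ← toWitness {a? = a Fin.≟ b} e = leaf
  iso⇒≅ (node s t) (node s′ t′) e with T-∨ .to e
  ... | inj₁ e′ = node (iso⇒≅ s s′ (proj₁ (T-∧ .to e′))) (iso⇒≅ t t′ (proj₂ (T-∧ .to e′)))
  ... | inj₂ e′ = swap (iso⇒≅ s t′ (proj₁ (T-∧ .to e′))) (iso⇒≅ t s′ (proj₂ (T-∧ .to e′)))

  ≅⇒iso : ∀ {s t : Tree (Fin k)} → s ≅ t → T (iso s t)
  ≅⇒iso (leaf {a}) = fromWitness {a? = a Fin.≟ a} refl
  ≅⇒iso (node p q) = T-∨ .from (inj₁ (T-∧ .from (≅⇒iso p , ≅⇒iso q)))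
  ≅⇒iso (swap p q) = T-∨ .from (inj₂ (T-∧ .from (≅⇒iso p , ≅⇒iso q)))

  iso-refl : (t : Tree (Fin k)) → T (iso t t)
  iso-refl t = ≅⇒iso (≅-refl t)

module _ {k : ℕ} where

  iso-respˡ : ∀ {s s′} (t : Tree (Fin k)) → s ≅ s′ → iso s t ≡ iso s′ t
  iso-respˡ {s} {s′} t p = T-ext (λ e → ≅⇒iso (≅-trans (≅-sym p) (iso⇒≅ s t e)))
                                 (λ e → ≅⇒iso (≅-trans p (iso⇒≅ s′ t e)))

  iso-respʳ : ∀ (s : Tree (Fin k)) {t t′} → t ≅ t′ → iso s t ≡ iso s t′
  iso-respʳ s {t} {t′} p = T-ext (λ e → ≅⇒iso (≅-trans (iso⇒≅ s t e) p))
                                 (λ e → ≅⇒iso (≅-trans (iso⇒≅ s t′ e) (≅-sym p)))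

  iso-sym : (s t : Tree (Fin k)) → iso s t ≡ iso t s
  iso-sym s t = T-ext (λ e → ≅⇒iso (≅-sym (iso⇒≅ s t e))) (λ e → ≅⇒iso (≅-sym (iso⇒≅ t s e)))

map-leftInverse : ∀ {A B : Set} {f : A → B} {g : B → A} → (∀ x → g (f x) ≡ x) →
                  (t : Tree A) → map g (map f t) ≡ t
map-leftInverse g∘f (leaf a)   = cong leaf (g∘f a)
map-leftInverse g∘f (node s t) = cong₂ node (map-leftInverse g∘f s) (map-leftInverse g∘f t)

iso-map : ∀ {k l} {f : Fin k → Fin l} {g : Fin l → Fin k} → (∀ x → g (f x) ≡ x) →
          (s t : Tree (Fin k)) → iso (map f s) (map f t) ≡ iso s t
iso-map {f = f} {g} g∘f s t = T-ext
  (λ e → ≅⇒iso (subst₂ _≅_ (map-leftInverse g∘f s) (map-leftInverse g∘f t)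
                 (map-≅ g (iso⇒≅ (map f s) (map f t) e))))
  (λ e → ≅⇒iso (map-≅ f (iso⇒≅ s t e)))

-- Weighted sums

𝟙 : Bool → ℚ
𝟙 b = if b then 1ℚ else 0ℚ

if-then-0≡*𝟙 : ∀ b w → (if b then w else 0ℚ) ≡ w * 𝟙 b
if-then-0≡*𝟙 true  w = sym (ℚₚ.*-identityʳ w)
if-then-0≡*𝟙 false w = sym (ℚₚ.*-zeroʳ w)

0≤𝟙 : ∀ b → 0ℚ ℚ.≤ 𝟙 b
0≤𝟙 true  = ℚₚ.nonNegative⁻¹ 1ℚ
0≤𝟙 false = ℚₚ.≤-refl

0≤+ : ∀ {a b} → 0ℚ ℚ.≤ a → 0ℚ ℚ.≤ b → 0ℚ ℚ.≤ a + b
0≤+ {a} {b} 0≤a 0≤b = subst (ℚ._≤ a + b) (ℚₚ.+-identityˡ 0ℚ) (ℚₚ.+-mono-≤ 0≤a 0≤b)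

0≤* : ∀ {a b} → 0ℚ ℚ.≤ a → 0ℚ ℚ.≤ b → 0ℚ ℚ.≤ a * b
0≤* {a} {b} 0≤a 0≤b =
  subst (ℚ._≤ a * b) (ℚₚ.*-zeroʳ a) (ℚₚ.*-monoˡ-≤-nonNeg a {{nonNegative 0≤a}} 0≤b)

+≡0⇒≡0ˡ : ∀ {a b} → 0ℚ ℚ.≤ a → 0ℚ ℚ.≤ b → a + b ≡ 0ℚ → a ≡ 0ℚ
+≡0⇒≡0ˡ {a} {b} 0≤a 0≤b a+b≡0 = ℚₚ.≤-antisym a≤0 0≤a
  where
  a≤0 : a ℚ.≤ 0ℚ
  a≤0 = subst₂ ℚ._≤_ (ℚₚ.+-identityʳ a) a+b≡0 (ℚₚ.+-monoʳ-≤ a 0≤b)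

+≡0⇒≡0ʳ : ∀ {a b} → 0ℚ ℚ.≤ a → 0ℚ ℚ.≤ b → a + b ≡ 0ℚ → b ≡ 0ℚ
+≡0⇒≡0ʳ {a} {b} 0≤a 0≤b a+b≡0 = +≡0⇒≡0ˡ 0≤b 0≤a (trans (ℚₚ.+-comm b a) a+b≡0)

module _ {A : Set} where

  expect : List (A × ℚ) → (A → ℚ) → ℚ
  expect []             h = 0ℚ
  expect ((a , w) ∷ xs) h = w * h a + expect xs h

  NonNegWeights : List (A × ℚ) → Set
  NonNegWeights = All (λ e → 0ℚ ℚ.≤ proj₂ e)

  expect-cong-on : ∀ {h g : A → ℚ} {xs} →
    All (λ e → proj₂ e * h (proj₁ e) ≡ proj₂ e * g (proj₁ e)) xs → expect xs h ≡ expect xs g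
  expect-cong-on []       = refl
  expect-cong-on (e ∷ es) = cong₂ _+_ e (expect-cong-on es)

  expect-cong : ∀ {h g : A → ℚ} xs → (∀ a → h a ≡ g a) → expect xs h ≡ expect xs g
  expect-cong xs h≗g = expect-cong-on (All.universal (λ e → cong (proj₂ e *_) (h≗g (proj₁ e))) xs)

  expect-zero-on : ∀ {h : A → ℚ} {xs} → All (λ e → proj₂ e * h (proj₁ e) ≡ 0ℚ) xs → expect xs h ≡ 0ℚ
  expect-zero-on []       = refl
  expect-zero-on (e ∷ es) = trans (cong₂ _+_ e (expect-zero-on es)) (ℚₚ.+-identityˡ 0ℚ)

  expect-const : ∀ xs c → expect xs (λ _ → c) ≡ sumW xs * c
  expect-const []             c = sym (ℚₚ.*-zeroˡ c)
  expect-const ((a , w) ∷ xs) c = begin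
    w * c + expect xs (λ _ → c) ≡⟨ cong (w * c +_) (expect-const xs c) ⟩
    w * c + sumW xs * c         ≡⟨ ℚₚ.*-distribʳ-+ c w (sumW xs) ⟨
    (w + sumW xs) * c           ∎

  expect-+ : ∀ xs (h g : A → ℚ) → expect xs (λ a → h a + g a) ≡ expect xs h + expect xs g
  expect-+ []             h g = sym (ℚₚ.+-identityˡ 0ℚ)
  expect-+ ((a , w) ∷ xs) h g = begin
    w * (h a + g a) + expect xs (λ a → h a + g a)
      ≡⟨ cong (w * (h a + g a) +_) (expect-+ xs h g) ⟩
    w * (h a + g a) + (expect xs h + expect xs g)
      ≡⟨ rearrange w (h a) (g a) (expect xs h) (expect xs g) ⟩
    (w * h a + expect xs h) + (w * g a + expect xs g) ∎
    where
    open +-*-Solver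
    rearrange : ∀ w x y X Y → w * (x + y) + (X + Y) ≡ (w * x + X) + (w * y + Y)
    rearrange = solve 5 (λ w x y X Y → w :* (x :+ y) :+ (X :+ Y) := (w :* x :+ X) :+ (w :* y :+ Y))
                        refl

  *-expect : ∀ c xs (h : A → ℚ) → c * expect xs h ≡ expect xs (λ a → c * h a)
  *-expect c []             h = ℚₚ.*-zeroʳ c
  *-expect c ((a , w) ∷ xs) h = begin
    c * (w * h a + expect xs h)          ≡⟨ rearrange c w (h a) (expect xs h) ⟩
    w * (c * h a) + c * expect xs h      ≡⟨ cong (w * (c * h a) +_) (*-expect c xs h) ⟩
    w * (c * h a) + expect xs (λ a → c * h a) ∎
    where
    open +-*-Solver
    rearrange : ∀ c w x X → c * (w * x + X) ≡ w * (c * x) + c * X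
    rearrange = solve 4 (λ c w x X → c :* (w :* x :+ X) := w :* (c :* x) :+ c :* X) refl

  expect-nonNeg : ∀ {xs} {h : A → ℚ} → NonNegWeights xs → (∀ a → 0ℚ ℚ.≤ h a) → 0ℚ ℚ.≤ expect xs h
  expect-nonNeg []         0≤h = ℚₚ.≤-refl
  expect-nonNeg (0≤w ∷ ws) 0≤h = 0≤+ (0≤* 0≤w (0≤h _)) (expect-nonNeg ws 0≤h)

  expect≡0⇒term≡0 : ∀ {xs} {h : A → ℚ} → NonNegWeights xs → (∀ a → 0ℚ ℚ.≤ h a) →
    expect xs h ≡ 0ℚ → ∀ {e} → e ∈ xs → proj₂ e * h (proj₁ e) ≡ 0ℚ
  expect≡0⇒term≡0 (0≤w ∷ ws) 0≤h sum≡0 (here refl) =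
    +≡0⇒≡0ˡ (0≤* 0≤w (0≤h _)) (expect-nonNeg ws 0≤h) sum≡0
  expect≡0⇒term≡0 (0≤w ∷ ws) 0≤h sum≡0 (there e∈xs) =
    expect≡0⇒term≡0 ws 0≤h (+≡0⇒≡0ʳ (0≤* 0≤w (0≤h _)) (expect-nonNeg ws 0≤h) sum≡0) e∈xs

expect-map₁ : ∀ {A B : Set} (f : B → A) xs (h : A → ℚ) →
              expect (List.map (Product.map₁ f) xs) h ≡ expect xs (h ∘ f)
expect-map₁ f []             h = refl
expect-map₁ f ((b , w) ∷ xs) h = cong (w * h (f b) +_) (expect-map₁ f xs h)

expect-𝟙≡0⇒weight≡0 : ∀ {A : Set} {xs} (P : A → Bool) → NonNegWeights xs → expect xs (𝟙 ∘ P) ≡ 0ℚ →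
  ∀ {a w} → (a , w) ∈ xs → T (P a) → w ≡ 0ℚ
expect-𝟙≡0⇒weight≡0 P ws sum≡0 {a} e∈xs Pa with P a | expect≡0⇒term≡0 ws (0≤𝟙 ∘ P) sum≡0 e∈xs
... | true | w*1≡0 = trans (sym (ℚₚ.*-identityʳ _)) w*1≡0

expect-comm : ∀ {A B : Set} (xs : List (A × ℚ)) (ys : List (B × ℚ)) (K : A → B → ℚ) →
  expect xs (λ a → expect ys (K a)) ≡ expect ys (λ b → expect xs (λ a → K a b))
expect-comm []             ys K = sym (trans (expect-const ys 0ℚ) (ℚₚ.*-zeroʳ (sumW ys)))
expect-comm ((a , w) ∷ xs) ys K = begin
  w * expect ys (K a) + expect xs (λ a → expect ys (K a))
    ≡⟨ cong₂ _+_ (*-expect w ys (K a)) (expect-comm xs ys K) ⟩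
  expect ys (λ b → w * K a b) + expect ys (λ b → expect xs (λ a → K a b))
    ≡⟨ expect-+ ys (λ b → w * K a b) (λ b → expect xs (λ a → K a b)) ⟨
  expect ys (λ b → w * K a b + expect xs (λ a → K a b)) ∎

module _ {k : ℕ} where

  massL≡expect : ∀ xs (Q : Tree (Fin k)) → massL xs Q ≡ expect xs (λ t → 𝟙 (iso t Q))
  massL≡expect []             Q = refl
  massL≡expect ((t , w) ∷ xs) Q = cong₂ _+_ (if-then-0≡*𝟙 (iso t Q) w) (massL≡expect xs Q)

  massL-support : ∀ xs (Q : Tree (Fin k)) → massL xs Q ≡ 0ℚ ⊎ Any (λ e → proj₁ e ≅ Q) xs
  massL-support []             Q = inj₁ refl
  massL-support ((t , w) ∷ xs) Q with iso t Q in e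
  ... | true  = inj₂ (here (iso⇒≅ t Q (T-≡ .from e)))
  ... | false with massL-support xs Q
  ...   | inj₁ m≡0 = inj₁ (trans (ℚₚ.+-identityˡ _) m≡0)
  ...   | inj₂ hit = inj₂ (there hit)

-- Induction on the total length: the ≅-class of a head entry contributes (its mass) · h to
-- both sums, and removing that class from both lists keeps their masses equal.
module _ {k : ℕ} (h : Tree (Fin k) → ℚ) (h-resp : ∀ {s t} → s ≅ t → h s ≡ h t) where

  private
    withoutClass : Tree (Fin k) → List (Tree (Fin k) × ℚ) → List (Tree (Fin k) × ℚ)
    withoutClass t = filterᵇ (λ e → not (iso (proj₁ e) t))

    length-withoutClass-head : ∀ t w xs → length (withoutClass t ((t , w) ∷ xs)) ≤ length xs
    length-withoutClass-head t w xs rewrite T-≡ .to (iso-refl t) = List.length-filter _ xs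

    massL-withoutClass : ∀ t xs Q →
      massL (withoutClass t xs) Q ≡ (if iso t Q then 0ℚ else massL xs Q)
    massL-withoutClass t []             Q with iso t Q
    ... | true  = refl
    ... | false = refl
    massL-withoutClass t ((u , w) ∷ xs) Q
      with iso u t in u≅t | iso t Q in t≅Q | massL-withoutClass t xs Q
    ... | true  | true  | ih = ih
    ... | true  | false | ih = trans ih (sym (trans (cong (λ b → (if b then w else 0ℚ) + _) u≇Q)
                                                  (ℚₚ.+-identityˡ _)))
      where
      u≇Q : iso u Q ≡ false
      u≇Q = trans (iso-respˡ Q (iso⇒≅ u t (T-≡ .from u≅t))) t≅Q
    ... | false | true  | ih = trans (cong₂ (λ b m → (if b then w else 0ℚ) + m) u≇Q ih)
                                   (ℚₚ.+-identityˡ 0ℚ)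
      where
      u≇Q : iso u Q ≡ false
      u≇Q = trans (sym (iso-respʳ u (iso⇒≅ t Q (T-≡ .from t≅Q)))) u≅t
    ... | false | false | ih = cong ((if iso u Q then w else 0ℚ) +_) ih

    expect-withoutClass : ∀ t xs → expect xs h ≡ massL xs t * h t + expect (withoutClass t xs) h
    expect-withoutClass t []             =
      sym (trans (cong (_+ 0ℚ) (ℚₚ.*-zeroˡ (h t))) (ℚₚ.+-identityˡ 0ℚ))
    expect-withoutClass t ((u , w) ∷ xs) with iso u t in u≅t
    ... | true = begin
      w * h u + expect xs h
        ≡⟨ cong₂ (λ x E → w * x + E) (h-resp (iso⇒≅ u t (T-≡ .from u≅t)))
                 (expect-withoutClass t xs) ⟩
      w * h t + (massL xs t * h t + expect (withoutClass t xs) h)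
        ≡⟨ rearrange w (h t) (massL xs t) _ ⟩
      (w + massL xs t) * h t + expect (withoutClass t xs) h ∎
      where
      open +-*-Solver
      rearrange : ∀ w x M E → w * x + (M * x + E) ≡ (w + M) * x + E
      rearrange = solve 4 (λ w x M E → w :* x :+ (M :* x :+ E) := (w :+ M) :* x :+ E) refl
    ... | false = begin
      w * h u + expect xs h
        ≡⟨ cong (w * h u +_) (expect-withoutClass t xs) ⟩
      w * h u + (massL xs t * h t + expect (withoutClass t xs) h)
        ≡⟨ rearrange (w * h u) (massL xs t * h t) _ ⟩
      massL xs t * h t + (w * h u + expect (withoutClass t xs) h)
        ≡⟨ cong (λ M → M * h t + (w * h u + expect (withoutClass t xs) h))
                (ℚₚ.+-identityˡ (massL xs t)) ⟨
      (0ℚ + massL xs t) * h t + (w * h u + expect (withoutClass t xs) h) ∎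
      where
      open +-*-Solver
      rearrange : ∀ a b E → a + (b + E) ≡ b + (a + E)
      rearrange = solve 3 (λ a b E → a :+ (b :+ E) := b :+ (a :+ E)) refl

    peelClass : ∀ t xs ys → (∀ Q → massL xs Q ≡ massL ys Q) →
      expect (withoutClass t xs) h ≡ expect (withoutClass t ys) h → expect xs h ≡ expect ys h
    peelClass t xs ys mass≡ rest≡ = begin
      expect xs h                                     ≡⟨ expect-withoutClass t xs ⟩
      massL xs t * h t + expect (withoutClass t xs) h ≡⟨ cong₂ (λ M E → M * h t + E) (mass≡ t) rest≡ ⟩
      massL ys t * h t + expect (withoutClass t ys) h ≡⟨ expect-withoutClass t ys ⟨
      expect ys h                                     ∎

    withoutClass-resp-mass : ∀ t xs ys → (∀ Q → massL xs Q ≡ massL ys Q) →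
      ∀ Q → massL (withoutClass t xs) Q ≡ massL (withoutClass t ys) Q
    withoutClass-resp-mass t xs ys mass≡ Q = begin
      massL (withoutClass t xs) Q         ≡⟨ massL-withoutClass t xs Q ⟩
      (if iso t Q then 0ℚ else massL xs Q) ≡⟨ cong (if iso t Q then 0ℚ else_) (mass≡ Q) ⟩
      (if iso t Q then 0ℚ else massL ys Q) ≡⟨ massL-withoutClass t ys Q ⟨
      massL (withoutClass t ys) Q         ∎

    expect-determinedByMass-bounded : ∀ N xs ys → length xs ℕ.+ length ys ≤ N →
      (∀ Q → massL xs Q ≡ massL ys Q) → expect xs h ≡ expect ys h
    expect-determinedByMass-bounded _ [] [] _ _ = refl
    expect-determinedByMass-bounded (suc N) (e@(t , _) ∷ xs) ys (s≤s bound) mass≡ =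
      peelClass t (e ∷ xs) ys mass≡ (expect-determinedByMass-bounded N
        (withoutClass t (e ∷ xs)) (withoutClass t ys) bound′
        (withoutClass-resp-mass t (e ∷ xs) ys mass≡))
      where
      bound′ : length (withoutClass t (e ∷ xs)) ℕ.+ length (withoutClass t ys) ≤ N
      bound′ = ℕₚ.≤-trans
        (ℕₚ.+-mono-≤ (length-withoutClass-head t _ xs) (List.length-filter _ ys)) bound
    expect-determinedByMass-bounded (suc N) [] (e@(t , _) ∷ ys) (s≤s bound) mass≡ =
      peelClass t [] (e ∷ ys) mass≡ (expect-determinedByMass-bounded N
        [] (withoutClass t (e ∷ ys)) bound′ (withoutClass-resp-mass t [] (e ∷ ys) mass≡))
      where
      bound′ : length (withoutClass t (e ∷ ys)) ≤ N
      bound′ = ℕₚ.≤-trans (length-withoutClass-head t _ ys) bound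

  expect-determinedByMass : ∀ xs ys → (∀ Q → massL xs Q ≡ massL ys Q) → expect xs h ≡ expect ys h
  expect-determinedByMass xs ys = expect-determinedByMass-bounded _ xs ys ℕₚ.≤-refl

-- Combs and labelled trees

leaves-map : ∀ {A B : Set} (f : A → B) (t : Tree A) → leaves (map f t) ≡ List.map f (leaves t)
leaves-map f (leaf a)   = refl
leaves-map f (node s t) =
  trans (cong₂ _++_ (leaves-map f s) (leaves-map f t)) (sym (List.map-++ f (leaves s) (leaves t)))

module _ {A B : Set} (f : A → B) where

  isLeaf-map : ∀ t → IsLeaf t → IsLeaf (map f t)
  isLeaf-map (leaf _) _ = tt

  isComb-map : ∀ t → IsComb t → IsComb (map f t)
  isComb-map (leaf _)   _                  = tt
  isComb-map (node s t) (inj₁ l , cs , ct) = inj₁ (isLeaf-map s l) , isComb-map s cs , isComb-map t ct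
  isComb-map (node s t) (inj₂ l , cs , ct) = inj₂ (isLeaf-map t l) , isComb-map s cs , isComb-map t ct

module _ {A : Set} where

  isLeaf? : (t : Tree A) → Dec (IsLeaf t)
  isLeaf? (leaf _)   = yes tt
  isLeaf? (node _ _) = no (λ ())

  isComb? : (t : Tree A) → Dec (IsComb t)
  isComb? (leaf _)   = yes tt
  isComb? (node s t) = (isLeaf? s ⊎-dec isLeaf? t) ×-dec (isComb? s ×-dec isComb? t)

  spine : A → List A → Tree A
  spine a []      = leaf a
  spine a (b ∷ l) = node (leaf a) (spine b l)

  leaves-spine : ∀ a l → leaves (spine a l) ≡ a ∷ l
  leaves-spine a []      = refl
  leaves-spine a (b ∷ l) = cong (a ∷_) (leaves-spine b l)

  isComb⇒≅spine : (t : Tree A) → IsComb t → ∃₂ λ a l → t ≅ spine a l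
  isComb⇒≅spine (leaf a) _ = a , [] , leaf
  isComb⇒≅spine (node (leaf a) t) (inj₁ _ , _ , ct) with isComb⇒≅spine t ct
  ... | b , l , t≅ = a , b ∷ l , node leaf t≅
  isComb⇒≅spine (node s (leaf a)) (inj₂ _ , cs , _) with isComb⇒≅spine s cs
  ... | b , l , s≅ = a , b ∷ l , swap s≅ leaf

map-spine : ∀ {A B : Set} (f : A → B) a l → map f (spine a l) ≡ spine (f a) (List.map f l)
map-spine f a []      = refl
map-spine f a (b ∷ l) = cong (node (leaf (f a))) (map-spine f b l)

Unique-resp-↭ : ∀ {A : Set} {xs ys : List A} → xs ↭ ys → Unique xs → Unique ys
Unique-resp-↭ {A} xs↭ys = ↭ₛ.Unique-resp-↭ (setoid A) (↭⇒↭ₛ xs↭ys)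

module _ {k : ℕ} where

  unique∧complete⇒↭allFin : ∀ {xs} → Unique xs → (∀ z → z ∈ xs) → xs ↭ allFin k
  unique∧complete⇒↭allFin {xs} !xs complete = ∼bag⇒↭ (unique∧set⇒bag !xs (Unique.allFin⁺ k)
    λ {z} → mk⇔ (λ _ → ∈-allFin z) (λ _ → complete z))

  isLabelled-resp-≅ : ∀ {s t} → s ≅ t → IsLabelled k s → IsLabelled k t
  isLabelled-resp-≅ s≅t lab = ↭-trans (↭-sym (≅-leaves s≅t)) lab

  isLabelled-permute : (σ : Permutation′ k) (t : Tree (Fin k)) →
                       IsLabelled k t → IsLabelled k (map (σ ⟨$⟩ʳ_) t)
  isLabelled-permute σ t lab = subst (_↭ allFin k) (sym (leaves-map (σ ⟨$⟩ʳ_) t))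
    (↭-trans (↭.map⁺ (σ ⟨$⟩ʳ_) lab) (unique∧complete⇒↭allFin !σ[allFin] σ[allFin]-complete))
    where
    !σ[allFin] : Unique (List.map (σ ⟨$⟩ʳ_) (allFin k))
    !σ[allFin] = Unique.map⁺ (λ {x} {y} σx≡σy →
      trans (sym (inverseˡ σ)) (trans (cong (σ ⟨$⟩ˡ_) σx≡σy) (inverseˡ σ))) (Unique.allFin⁺ k)
    σ[allFin]-complete : ∀ z → z ∈ List.map (σ ⟨$⟩ʳ_) (allFin k)
    σ[allFin]-complete z = subst (_∈ _) (inverseʳ σ) (∈-map⁺ (σ ⟨$⟩ʳ_) (∈-allFin (σ ⟨$⟩ˡ z)))

-- Restriction to the labels below n

lowerLabel-zero : ∀ {m} (a : Fin m) → lowerLabel 0 a ≡ nothing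
lowerLabel-zero a with toℕ a ℕ.<? 0
... | no _ = refl

-- `_<?_` is computed through `_≤ᵇ_`, so the two decisions are unrelated definitionally.
lowerLabel-suc : ∀ {m} n (a : Fin m) → lowerLabel (suc n) (suc a) ≡ Maybe.map suc (lowerLabel n a)
lowerLabel-suc n a with toℕ a ℕ.<? n | suc (toℕ a) ℕ.<? suc n
... | yes _     | yes _      = refl
... | no _      | no _       = refl
... | yes a<n   | no a≮n     = ⊥-elim (a≮n (s≤s a<n))
... | no a≮n    | yes 1+a<1+n = ⊥-elim (a≮n (ℕ.s≤s⁻¹ 1+a<1+n))

mapMaybe-lowerLabel-allFin : ∀ {n m} → n ≤ m → mapMaybe (lowerLabel n) (allFin m) ≡ allFin n
mapMaybe-lowerLabel-allFin {m = m} z≤n =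
  trans (List.mapMaybe-cong lowerLabel-zero (allFin m)) (List.mapMaybe-nothing (allFin m))
mapMaybe-lowerLabel-allFin {suc n} {suc m} (s≤s n≤m) = cong (zero ∷_) (begin
  mapMaybe (lowerLabel (suc n)) (List.tabulate {n = m} suc)
    ≡⟨ cong (mapMaybe (lowerLabel (suc n))) (List.map-tabulate {n = m} id suc) ⟨
  mapMaybe (lowerLabel (suc n)) (List.map suc (allFin m))
    ≡⟨ List.mapMaybe-map (lowerLabel (suc n)) suc (allFin m) ⟩
  mapMaybe (lowerLabel (suc n) ∘ suc) (allFin m)
    ≡⟨ List.mapMaybe-cong (lowerLabel-suc n) (allFin m) ⟩
  mapMaybe (Maybe.map suc ∘ lowerLabel n) (allFin m)
    ≡⟨ List.map-mapMaybe suc (lowerLabel n) (allFin m) ⟨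
  List.map suc (mapMaybe (lowerLabel n) (allFin m))
    ≡⟨ cong (List.map suc) (mapMaybe-lowerLabel-allFin n≤m) ⟩
  List.map suc (allFin n)
    ≡⟨ List.map-tabulate {n = n} id suc ⟩
  List.tabulate suc ∎)

module _ {n m : ℕ} (n≤m : n ≤ m) where

  lowerLabel-inject≤ : (c : Fin n) → lowerLabel n (inject≤ c n≤m) ≡ just c
  lowerLabel-inject≤ c with toℕ (inject≤ c n≤m) ℕ.<? n
  ... | yes _ = cong just (Fin.toℕ-injective (trans (Fin.toℕ-fromℕ< _) (Fin.toℕ-inject≤ c n≤m)))
  ... | no c≮n = ⊥-elim (c≮n (subst (ℕ._< n) (sym (Fin.toℕ-inject≤ c n≤m)) (Fin.toℕ<n c)))

  lowerLabel≡just⇒inject≤ : ∀ a {c} → lowerLabel n a ≡ just c → a ≡ inject≤ c n≤m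
  lowerLabel≡just⇒inject≤ a e with toℕ a ℕ.<? n
  lowerLabel≡just⇒inject≤ a refl | yes a<n =
    Fin.toℕ-injective (trans (sym (Fin.toℕ-fromℕ< a<n)) (sym (Fin.toℕ-inject≤ _ n≤m)))

module _ {A : Set} where

  nodeᵐ : Maybe (Tree A) → Maybe (Tree A) → Maybe (Tree A)
  nodeᵐ (just s) (just t) = just (node s t)
  nodeᵐ (just s) nothing  = just s
  nodeᵐ nothing  t        = t

  leavesᵐ : Maybe (Tree A) → List A
  leavesᵐ = Maybe.maybe leaves []

  leavesᵐ-nodeᵐ : ∀ x y → leavesᵐ (nodeᵐ x y) ≡ leavesᵐ x ++ leavesᵐ y
  leavesᵐ-nodeᵐ (just s) (just t) = refl
  leavesᵐ-nodeᵐ (just s) nothing  = sym (List.++-identityʳ (leaves s))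
  leavesᵐ-nodeᵐ nothing  y        = refl

  nodeᵐ-resp-≅ : ∀ {x x′ y y′} → Pointwise _≅_ x x′ → Pointwise _≅_ y y′ →
                 Pointwise _≅_ (nodeᵐ x y) (nodeᵐ x′ y′)
  nodeᵐ-resp-≅ (just p) (just q) = just (node p q)
  nodeᵐ-resp-≅ (just p) nothing  = just p
  nodeᵐ-resp-≅ nothing  q        = q

  nodeᵐ-swap-≅ : ∀ {x x′ y y′} → Pointwise _≅_ x y′ → Pointwise _≅_ y x′ →
                 Pointwise _≅_ (nodeᵐ x y) (nodeᵐ x′ y′)
  nodeᵐ-swap-≅ (just p) (just q) = just (swap p q)
  nodeᵐ-swap-≅ (just p) nothing  = just p
  nodeᵐ-swap-≅ nothing  (just q) = just q
  nodeᵐ-swap-≅ nothing  nothing  = nothing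

  nodeᵐ-isCombˡ : ∀ {x y} → MaybeAll.All IsLeaf x → MaybeAll.All IsComb x → MaybeAll.All IsComb y →
                  MaybeAll.All IsComb (nodeᵐ x y)
  nodeᵐ-isCombˡ (just l) (just cs) (just ct) = just (inj₁ l , cs , ct)
  nodeᵐ-isCombˡ (just _) (just cs) nothing   = just cs
  nodeᵐ-isCombˡ nothing  nothing   cy        = cy

  nodeᵐ-isCombʳ : ∀ {x y} → MaybeAll.All IsLeaf y → MaybeAll.All IsComb x → MaybeAll.All IsComb y →
                  MaybeAll.All IsComb (nodeᵐ x y)
  nodeᵐ-isCombʳ (just l) (just cs) (just ct) = just (inj₂ l , cs , ct)
  nodeᵐ-isCombʳ nothing  (just cs) nothing   = just cs
  nodeᵐ-isCombʳ _        nothing   cy        = cy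

nodeᵐ-map : ∀ {A B : Set} (f : A → B) x y →
            nodeᵐ (Maybe.map (map f) x) (Maybe.map (map f) y) ≡ Maybe.map (map f) (nodeᵐ x y)
nodeᵐ-map f (just s) (just t) = refl
nodeᵐ-map f (just s) nothing  = refl
nodeᵐ-map f nothing  y        = refl

module _ {m : ℕ} (n : ℕ) where

  restrict-leaf : ∀ a → restrict {m} n (leaf a) ≡ Maybe.map leaf (lowerLabel n a)
  restrict-leaf a with lowerLabel n a
  ... | just _  = refl
  ... | nothing = refl

  restrict-node : ∀ s t → restrict {m} n (node s t) ≡ nodeᵐ (restrict n s) (restrict n t)
  restrict-node s t with restrict n s | restrict n t
  ... | just _  | just _  = refl
  ... | just _  | nothing = refl
  ... | nothing | just _  = refl
  ... | nothing | nothing = refl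

  restrict-≅ : ∀ {s t : Tree (Fin m)} → s ≅ t → Pointwise _≅_ (restrict n s) (restrict n t)
  restrict-≅ {leaf a} leaf = Pointwise.refl (λ {t} → ≅-refl t)
  restrict-≅ (node {s} {t} {s′} {t′} p q)
    rewrite restrict-node s t | restrict-node s′ t′ = nodeᵐ-resp-≅ (restrict-≅ p) (restrict-≅ q)
  restrict-≅ (swap {s} {t} {s′} {t′} p q)
    rewrite restrict-node s t | restrict-node s′ t′ = nodeᵐ-swap-≅ (restrict-≅ p) (restrict-≅ q)

  restrict-relabel : (σ : Fin m → Fin m) (ρ : Fin n → Fin n) →
    (∀ a → lowerLabel n (σ a) ≡ Maybe.map ρ (lowerLabel n a)) →
    ∀ t → restrict n (map σ t) ≡ Maybe.map (map ρ) (restrict n t)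
  restrict-relabel σ ρ compatible (leaf a) = begin
    restrict n (leaf (σ a))                     ≡⟨ restrict-leaf (σ a) ⟩
    Maybe.map leaf (lowerLabel n (σ a))         ≡⟨ cong (Maybe.map leaf) (compatible a) ⟩
    Maybe.map leaf (Maybe.map ρ (lowerLabel n a)) ≡⟨ Maybe.map-∘ (lowerLabel n a) ⟨
    Maybe.map (map ρ ∘ leaf) (lowerLabel n a)   ≡⟨ Maybe.map-∘ (lowerLabel n a) ⟩
    Maybe.map (map ρ) (Maybe.map leaf (lowerLabel n a))
      ≡⟨ cong (Maybe.map (map ρ)) (restrict-leaf a) ⟨
    Maybe.map (map ρ) (restrict n (leaf a))     ∎
  restrict-relabel σ ρ compatible (node s t) = begin
    restrict n (node (map σ s) (map σ t))
      ≡⟨ restrict-node (map σ s) (map σ t) ⟩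
    nodeᵐ (restrict n (map σ s)) (restrict n (map σ t))
      ≡⟨ cong₂ nodeᵐ (restrict-relabel σ ρ compatible s) (restrict-relabel σ ρ compatible t) ⟩
    nodeᵐ (Maybe.map (map ρ) (restrict n s)) (Maybe.map (map ρ) (restrict n t))
      ≡⟨ nodeᵐ-map ρ (restrict n s) (restrict n t) ⟩
    Maybe.map (map ρ) (nodeᵐ (restrict n s) (restrict n t))
      ≡⟨ cong (Maybe.map (map ρ)) (restrict-node s t) ⟨
    Maybe.map (map ρ) (restrict n (node s t)) ∎

  restrict-isLeaf : ∀ (t : Tree (Fin m)) → IsLeaf t → MaybeAll.All IsLeaf (restrict n t)
  restrict-isLeaf (leaf a) _ rewrite restrict-leaf a with lowerLabel n a
  ... | just _  = just tt
  ... | nothing = nothing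

  restrict-isComb : ∀ (t : Tree (Fin m)) → IsComb t → MaybeAll.All IsComb (restrict n t)
  restrict-isComb (leaf a) _ rewrite restrict-leaf a with lowerLabel n a
  ... | just _  = just tt
  ... | nothing = nothing
  restrict-isComb (node s t) (inj₁ l , cs , ct) rewrite restrict-node s t =
    nodeᵐ-isCombˡ (restrict-isLeaf s l) (restrict-isComb s cs) (restrict-isComb t ct)
  restrict-isComb (node s t) (inj₂ l , cs , ct) rewrite restrict-node s t =
    nodeᵐ-isCombʳ (restrict-isLeaf t l) (restrict-isComb s cs) (restrict-isComb t ct)

  leavesᵐ-restrict : ∀ (t : Tree (Fin m)) →
                     leavesᵐ (restrict n t) ≡ mapMaybe (lowerLabel n) (leaves t)
  leavesᵐ-restrict (leaf a) rewrite restrict-leaf a with lowerLabel n a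
  ... | just _  = refl
  ... | nothing = refl
  leavesᵐ-restrict (node s t) = begin
    leavesᵐ (restrict n (node s t))                   ≡⟨ cong leavesᵐ (restrict-node s t) ⟩
    leavesᵐ (nodeᵐ (restrict n s) (restrict n t))
      ≡⟨ leavesᵐ-nodeᵐ (restrict n s) (restrict n t) ⟩
    leavesᵐ (restrict n s) ++ leavesᵐ (restrict n t)
      ≡⟨ cong₂ _++_ (leavesᵐ-restrict s) (leavesᵐ-restrict t) ⟩
    mapMaybe (lowerLabel n) (leaves s) ++ mapMaybe (lowerLabel n) (leaves t)
      ≡⟨ List.mapMaybe-++ (lowerLabel n) (leaves s) (leaves t) ⟨
    mapMaybe (lowerLabel n) (leaves s ++ leaves t)    ∎

leavesᵐ-restrict-↭ : ∀ {n m} → n ≤ m → (t : Tree (Fin m)) → IsLabelled m t →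
                     leavesᵐ (restrict n t) ↭ allFin n
leavesᵐ-restrict-↭ {n} n≤m t lab = subst (_↭ allFin n) (sym (leavesᵐ-restrict n t))
  (subst (mapMaybe (lowerLabel n) (leaves t) ↭_) (mapMaybe-lowerLabel-allFin n≤m)
    (↭.mapMaybe-↭ (lowerLabel n) lab))

restrict-isLabelled : ∀ {n m} → 1 ≤ n → n ≤ m → (t : Tree (Fin m)) → IsLabelled m t →
  Σ (Tree (Fin n)) λ R → restrict n t ≡ just R × IsLabelled n R
restrict-isLabelled {suc n′} _ n≤m t lab with restrict (suc n′) t | leavesᵐ-restrict-↭ n≤m t lab
... | just R  | R↭  = R , refl , R↭
... | nothing | []↭ with () ← ↭.↭-empty-inv (↭-sym []↭)

-- Transpositions and the orbit of the combs

module _ {k : ℕ} (i j : Fin k) where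

  transpose-matchˡ : transpose i j i ≡ j
  transpose-matchˡ rewrite dec-true (i Fin.≟ i) refl = refl

  transpose-matchʳ : transpose i j j ≡ i
  transpose-matchʳ with j Fin.≟ i
  ... | yes j≡i = j≡i
  ... | no _ rewrite dec-true (j Fin.≟ j) refl = refl

  transpose-other : ∀ {a} → a ≢ i → a ≢ j → transpose i j a ≡ a
  transpose-other {a} a≢i a≢j rewrite dec-false (a Fin.≟ i) a≢i | dec-false (a Fin.≟ j) a≢j = refl

transpose-injective-comm : ∀ {k l} {f : Fin k → Fin l} → (∀ {x y} → f x ≡ f y → x ≡ y) →
  ∀ i j a → transpose (f i) (f j) (f a) ≡ f (transpose i j a)
transpose-injective-comm {f = f} f-inj i j a = by-cases (a Fin.≟ i) (a Fin.≟ j)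
  where
  by-cases : Dec (a ≡ i) → Dec (a ≡ j) → transpose (f i) (f j) (f a) ≡ f (transpose i j a)
  by-cases (yes refl) _          =
    trans (transpose-matchˡ (f a) (f j)) (cong f (sym (transpose-matchˡ a j)))
  by-cases (no _)     (yes refl) =
    trans (transpose-matchʳ (f i) (f a)) (cong f (sym (transpose-matchʳ i a)))
  by-cases (no a≢i)   (no a≢j)   =
    trans (transpose-other (f i) (f j) (a≢i ∘ f-inj) (a≢j ∘ f-inj))
          (cong f (sym (transpose-other i j a≢i a≢j)))

lowerLabel-transpose : ∀ {n m} (n≤m : n ≤ m) (i j : Fin n) (a : Fin m) →
  lowerLabel n (transpose (inject≤ i n≤m) (inject≤ j n≤m) a) ≡
  Maybe.map (transpose i j) (lowerLabel n a)
lowerLabel-transpose {n} n≤m i j a with lowerLabel n a in eq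
... | just c rewrite lowerLabel≡just⇒inject≤ n≤m a eq = begin
  lowerLabel n (transpose (ι i) (ι j) (ι c))
    ≡⟨ cong (lowerLabel n) (transpose-injective-comm ι-injective i j c) ⟩
  lowerLabel n (ι (transpose i j c))
    ≡⟨ lowerLabel-inject≤ n≤m (transpose i j c) ⟩
  just (transpose i j c) ∎
  where
  ι = λ (c : Fin n) → inject≤ c n≤m
  ι-injective : ∀ {x y} → ι x ≡ ι y → x ≡ y
  ι-injective = Fin.inject≤-injective n≤m n≤m _ _
... | nothing = trans (cong (lowerLabel n) (transpose-other _ _ (a≢ι i) (a≢ι j))) eq
  where
  a≢ι : ∀ c → a ≢ inject≤ c n≤m
  a≢ι c refl with () ← trans (sym eq) (lowerLabel-inject≤ n≤m c)

module _ {k : ℕ} {B : Set} where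

  SwapInvariantOn : List (Fin k) → (List (Fin k) → B) → Set
  SwapInvariantOn S H = ∀ {i j} → i ∈ S → j ∈ S → ∀ l → H (List.map (transpose i j) l) ≡ H l

  swapInvariantOn-∷ : ∀ {x xs H} → x ∉ xs → SwapInvariantOn (x ∷ xs) H →
                      SwapInvariantOn xs (H ∘ (x ∷_))
  swapInvariantOn-∷ {x} {xs} {H} x∉xs inv {i} {j} i∈xs j∈xs l = begin
    H (x ∷ List.map τ l)   ≡⟨ cong (λ y → H (y ∷ List.map τ l))
                                   (transpose-other i j (x≢ i∈xs) (x≢ j∈xs)) ⟨
    H (List.map τ (x ∷ l)) ≡⟨ inv (there i∈xs) (there j∈xs) (x ∷ l) ⟩
    H (x ∷ l)              ∎
    where
    τ = transpose i j
    x≢ : ∀ {y} → y ∈ xs → x ≢ y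
    x≢ y∈xs refl = x∉xs y∈xs

  swapInvariantOn-swap : ∀ {S H x y zs} → SwapInvariantOn S H → x ∈ S → y ∈ S → x ∉ zs → y ∉ zs →
    H (x ∷ y ∷ zs) ≡ H (y ∷ x ∷ zs)
  swapInvariantOn-swap {S} {H} {x} {y} {zs} inv x∈S y∈S x∉zs y∉zs = begin
    H (x ∷ y ∷ zs)                               ≡⟨ inv x∈S y∈S (x ∷ y ∷ zs) ⟨
    H (τ x ∷ τ y ∷ List.map τ zs)                ≡⟨ cong H (cong₂ _∷_ (transpose-matchˡ x y)
                                                      (cong₂ _∷_ (transpose-matchʳ x y) zs-fixed)) ⟩
    H (y ∷ x ∷ zs)                               ∎
    where
    τ = transpose x y
    zs-fixed : List.map τ zs ≡ zs
    zs-fixed = List.map-id-local (All.tabulate λ z∈zs →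
      transpose-other x y (λ { refl → x∉zs z∈zs }) (λ { refl → y∉zs z∈zs }))

  ↭⇒swapInvariant≡ : ∀ {xs ys H} → xs ↭ ys → Unique xs → SwapInvariantOn xs H → H xs ≡ H ys
  ↭⇒swapInvariant≡ PR.refl _ _ = refl
  ↭⇒swapInvariant≡ (PR.prep x p) (x∉xs ∷ !xs) inv =
    ↭⇒swapInvariant≡ p !xs (swapInvariantOn-∷ (All¬⇒¬Any x∉xs) inv)
  ↭⇒swapInvariant≡ {H = H} (PR.swap {zs} {ws} x y p) ((x≢y ∷ x∉zs) ∷ y∉zs ∷ !zs) inv = begin
    H (x ∷ y ∷ zs) ≡⟨ ↭⇒swapInvariant≡ p !zs (swapInvariantOn-∷ (All¬⇒¬Any y∉zs)
                          (swapInvariantOn-∷ (All¬⇒¬Any (x≢y ∷ x∉zs)) inv)) ⟩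
    H (x ∷ y ∷ ws) ≡⟨ swapInvariantOn-swap inv (here refl) (there (here refl))
                          (All¬⇒¬Any x∉zs ∘ ↭.Any-resp-↭ (↭-sym p))
                          (All¬⇒¬Any y∉zs ∘ ↭.Any-resp-↭ (↭-sym p)) ⟩
    H (y ∷ x ∷ ws) ∎
  ↭⇒swapInvariant≡ (PR.trans p q) !xs inv =
    trans (↭⇒swapInvariant≡ p !xs inv)
          (↭⇒swapInvariant≡ q (Unique-resp-↭ p !xs)
            (λ i∈ j∈ → inv (↭.Any-resp-↭ (↭-sym p) i∈) (↭.Any-resp-↭ (↭-sym p) j∈)))

-- Both combs are ≅ to spines whose leaf lists are permutations of each other, and every
-- adjacent swap of a list without repetitions is realised by a transposition.
comb-orbit : ∀ {k} {B : Set} (G : Tree (Fin k) → B) → (∀ {s t} → s ≅ t → G s ≡ G t) →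
  (∀ i j t → G (map (transpose i j) t) ≡ G t) →
  ∀ {R R′} → IsLabelled k R → IsComb R → IsLabelled k R′ → IsComb R′ → G R ≡ G R′
comb-orbit {k} {B} G G-resp G-transpose {R} {R′} lab comb lab′ comb′
  with isComb⇒≅spine R comb | isComb⇒≅spine R′ comb′
... | a , l , R≅ | a′ , l′ , R′≅ = begin
  G R             ≡⟨ G-resp R≅ ⟩
  G (spine a l)   ≡⟨ Maybe.just-injective (↭⇒swapInvariant≡ spines↭ unique (λ _ _ → H-transpose)) ⟩
  G (spine a′ l′) ≡⟨ G-resp R′≅ ⟨
  G R′            ∎
  where
  H : List (Fin k) → Maybe B
  H []      = nothing
  H (b ∷ l) = just (G (spine b l))
  H-transpose : ∀ {i j} l → H (List.map (transpose i j) l) ≡ H l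
  H-transpose []               = refl
  H-transpose {i} {j} (b ∷ l) =
    cong just (trans (cong G (sym (map-spine (transpose i j) b l))) (G-transpose i j (spine b l)))
  spine↭allFin : ∀ {t b l} → t ≅ spine b l → IsLabelled k t → b ∷ l ↭ allFin k
  spine↭allFin {b = b} {l} t≅ lab =
    subst (_↭ allFin k) (leaves-spine b l) (isLabelled-resp-≅ t≅ lab)
  spines↭ : a ∷ l ↭ a′ ∷ l′
  spines↭ = ↭-trans (spine↭allFin R≅ lab) (↭-sym (spine↭allFin R′≅ lab′))
  unique : Unique (a ∷ l)
  unique = Unique-resp-↭ (↭-sym (spine↭allFin R≅ lab)) (Unique.allFin⁺ k)

-- Projections of exchangeable distributions

module _ {k : ℕ} where

  isoᵐ : Maybe (Tree (Fin k)) → Maybe (Tree (Fin k)) → Bool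
  isoᵐ (just s) (just t) = iso s t
  isoᵐ _        _        = false

  isoᵐ-sym : ∀ x y → isoᵐ x y ≡ isoᵐ y x
  isoᵐ-sym (just s) (just t) = iso-sym s t
  isoᵐ-sym (just s) nothing  = refl
  isoᵐ-sym nothing  (just t) = refl
  isoᵐ-sym nothing  nothing  = refl

  isoᵐ-respˡ : ∀ {x x′} y → Pointwise _≅_ x x′ → isoᵐ x y ≡ isoᵐ x′ y
  isoᵐ-respˡ (just t) (just s≅s′) = iso-respˡ t s≅s′
  isoᵐ-respˡ nothing  (just _)    = refl
  isoᵐ-respˡ _        nothing     = refl

  isoᵐ-respʳ : ∀ x {S S′} → S ≅ S′ → isoᵐ x (just S) ≡ isoᵐ x (just S′)
  isoᵐ-respʳ (just s) S≅S′ = iso-respʳ s S≅S′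
  isoᵐ-respʳ nothing  _    = refl

isoᵐ-map : ∀ {k l} {f : Fin k → Fin l} {g : Fin l → Fin k} → (∀ x → g (f x) ≡ x) →
  ∀ x R → isoᵐ (Maybe.map (map f) x) (just (map f R)) ≡ isoᵐ x (just R)
isoᵐ-map {g = g} g∘f (just s) R = iso-map {g = g} g∘f s R
isoᵐ-map g∘f nothing  R = refl

module _ {m : ℕ} (n : ℕ) where

  πᵐ : Dist m → Maybe (Tree (Fin n)) → ℚ
  πᵐ q x = expect (entries q) (λ t → 𝟙 (isoᵐ (restrict n t) x))

  piL≡expect : ∀ (xs : List (Tree (Fin m) × ℚ)) S →
               piL n xs S ≡ expect xs (λ t → 𝟙 (isoᵐ (restrict n t) (just S)))
  piL≡expect []             S = refl
  piL≡expect ((t , w) ∷ xs) S with restrict n t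
  ... | just t′ = cong₂ _+_ (if-then-0≡*𝟙 (iso t′ S) w) (piL≡expect xs S)
  ... | nothing =
    trans (piL≡expect xs S) (sym (trans (cong (_+ _) (ℚₚ.*-zeroʳ w)) (ℚₚ.+-identityˡ _)))

  π≡πᵐ : ∀ (q : Dist m) S → π n q S ≡ πᵐ q (just S)
  π≡πᵐ q S = piL≡expect (entries q) S

  π-nonNeg : ∀ (q : Dist m) S → 0ℚ ℚ.≤ π n q S
  π-nonNeg q S = subst (0ℚ ℚ.≤_) (sym (π≡πᵐ q S)) (expect-nonNeg (nonneg q) (λ _ → 0≤𝟙 _))

  π-resp-≅ : ∀ (q : Dist m) {S S′} → S ≅ S′ → π n q S ≡ π n q S′
  π-resp-≅ q {S} {S′} S≅S′ = begin
    π n q S       ≡⟨ π≡πᵐ q S ⟩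
    πᵐ q (just S)  ≡⟨ expect-cong (entries q) (λ t → cong 𝟙 (isoᵐ-respʳ (restrict n t) S≅S′)) ⟩
    πᵐ q (just S′) ≡⟨ π≡πᵐ q S′ ⟨
    π n q S′      ∎

  π≡0⇒weight≡0 : ∀ (q : Dist m) {R t w} → (t , w) ∈ entries q → restrict n t ≡ just R →
                 π n q R ≡ 0ℚ → w ≡ 0ℚ
  π≡0⇒weight≡0 q {R} {t} e∈q rt≡R πR≡0 =
    expect-𝟙≡0⇒weight≡0 (λ u → isoᵐ (restrict n u) (just R)) (nonneg q)
      (trans (sym (π≡πᵐ q R)) πR≡0) e∈q (subst (λ x → T (isoᵐ x (just R))) (sym rt≡R) (iso-refl R))

module _ {k : ℕ} where

  mass≡0⊎isLabelled : (d : Dist k) (Q : Tree (Fin k)) → mass d Q ≡ 0ℚ ⊎ IsLabelled k Q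
  mass≡0⊎isLabelled d Q with massL-support (entries d) Q
  ... | inj₁ m≡0 = inj₁ m≡0
  ... | inj₂ hit with All.lookupAny (labelled d) hit
  ...   | lab , t≅Q = inj₂ (isLabelled-resp-≅ t≅Q lab)

  mass-relabel : (d : Dist k) → Exchangeable d → (σ : Permutation′ k) → ∀ Q →
    massL (List.map (Product.map₁ (map (σ ⟨$⟩ʳ_))) (entries d)) Q ≡ mass d Q
  mass-relabel d ex σ Q = begin
    massL (List.map (Product.map₁ (map σʳ)) (entries d)) Q
      ≡⟨ massL≡expect (List.map (Product.map₁ (map σʳ)) (entries d)) Q ⟩
    expect (List.map (Product.map₁ (map σʳ)) (entries d)) (λ t → 𝟙 (iso t Q))
      ≡⟨ expect-map₁ (map σʳ) (entries d) _ ⟩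
    expect (entries d) (λ t → 𝟙 (iso (map σʳ t) Q))
      ≡⟨ expect-cong (entries d) (λ t → cong 𝟙 (trans (cong (iso (map σʳ t)) (sym σʳσˡQ≡Q))
           (iso-map {g = σˡ} (λ _ → inverseˡ σ) t (map σˡ Q)))) ⟩
    expect (entries d) (λ t → 𝟙 (iso t (map σˡ Q)))
      ≡⟨ massL≡expect (entries d) (map σˡ Q) ⟨
    mass d (map σˡ Q)
      ≡⟨ ex σ (map σˡ Q) ⟨
    mass d (map σʳ (map σˡ Q))
      ≡⟨ cong (mass d) σʳσˡQ≡Q ⟩
    mass d Q ∎
    where
    σʳ = σ ⟨$⟩ʳ_
    σˡ = σ ⟨$⟩ˡ_
    σʳσˡQ≡Q : map σʳ (map σˡ Q) ≡ Q
    σʳσˡQ≡Q = map-leftInverse (λ _ → inverseʳ σ) Q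

  combUniform⇒exchangeable : (d : Dist k) → IsCombUniform d → Exchangeable d
  combUniform⇒exchangeable d (offComb≡0 , combs≡) σ Q =
    by-support (mass≡0⊎isLabelled d Q) (mass≡0⊎isLabelled d (map σʳ Q))
    where
    σʳ = σ ⟨$⟩ʳ_
    σˡ = σ ⟨$⟩ˡ_
    σˡσʳQ≡Q : map σˡ (map σʳ Q) ≡ Q
    σˡσʳQ≡Q = map-leftInverse (λ _ → inverseˡ σ) Q
    labelled-case : IsLabelled k Q → mass d (map σʳ Q) ≡ mass d Q
    labelled-case lab with isComb? Q
    ... | yes comb = combs≡ _ _ (isLabelled-permute σ Q lab) (isComb-map σʳ Q comb) lab comb
    ... | no ¬comb =
      trans (offComb≡0 _ (isLabelled-permute σ Q lab) ¬comb′) (sym (offComb≡0 Q lab ¬comb))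
      where
      ¬comb′ : ¬ IsComb (map σʳ Q)
      ¬comb′ comb′ = ¬comb (subst IsComb σˡσʳQ≡Q (isComb-map σˡ _ comb′))
    by-support : mass d Q ≡ 0ℚ ⊎ IsLabelled k Q → mass d (map σʳ Q) ≡ 0ℚ ⊎ IsLabelled k (map σʳ Q) →
                 mass d (map σʳ Q) ≡ mass d Q
    by-support (inj₂ lab) _           = labelled-case lab
    by-support (inj₁ _)   (inj₂ lab′) =
      labelled-case (subst (IsLabelled k) σˡσʳQ≡Q (isLabelled-permute (Perm.flip σ) (map σʳ Q) lab′))
    by-support (inj₁ m≡0) (inj₁ m′≡0) = trans m′≡0 (sym m≡0)

module _ {m n : ℕ} (q : Dist m) (ex : Exchangeable q) where

  π-relabel : (σ : Permutation′ m) (ρ : Permutation′ n) →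
    (∀ a → lowerLabel n (σ ⟨$⟩ʳ a) ≡ Maybe.map (ρ ⟨$⟩ʳ_) (lowerLabel n a)) →
    ∀ R → π n q (map (ρ ⟨$⟩ʳ_) R) ≡ π n q R
  π-relabel σ ρ compatible R = begin
    π n q (map ρʳ R)
      ≡⟨ π≡πᵐ n q (map ρʳ R) ⟩
    expect (entries q) (hits (map ρʳ R))
      ≡⟨ expect-determinedByMass (hits (map ρʳ R)) (hits-resp-≅ (map ρʳ R))
           (entries q) relabelled (λ Q → sym (mass-relabel q ex σ Q)) ⟩
    expect relabelled (hits (map ρʳ R))
      ≡⟨ expect-map₁ (map σʳ) (entries q) (hits (map ρʳ R)) ⟩
    expect (entries q) (λ t → hits (map ρʳ R) (map σʳ t))
      ≡⟨ expect-cong (entries q) (λ t → cong 𝟙 (begin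
           isoᵐ (restrict n (map σʳ t)) (just (map ρʳ R))
             ≡⟨ cong (λ x → isoᵐ x (just (map ρʳ R))) (restrict-relabel n σʳ ρʳ compatible t) ⟩
           isoᵐ (Maybe.map (map ρʳ) (restrict n t)) (just (map ρʳ R))
             ≡⟨ isoᵐ-map {g = ρ ⟨$⟩ˡ_} (λ _ → inverseˡ ρ) (restrict n t) R ⟩
           isoᵐ (restrict n t) (just R) ∎)) ⟩
    expect (entries q) (hits R)
      ≡⟨ π≡πᵐ n q R ⟨
    π n q R ∎
    where
    σʳ = σ ⟨$⟩ʳ_
    ρʳ = ρ ⟨$⟩ʳ_
    relabelled = List.map (Product.map₁ (map σʳ)) (entries q)
    hits : Tree (Fin n) → Tree (Fin m) → ℚ
    hits S t = 𝟙 (isoᵐ (restrict n t) (just S))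
    hits-resp-≅ : ∀ S {s t} → s ≅ t → hits S s ≡ hits S t
    hits-resp-≅ S s≅t = cong 𝟙 (isoᵐ-respˡ (just S) (restrict-≅ n s≅t))

  module _ (n≤m : n ≤ m) where

    π-transpose : ∀ i j R → π n q (map (transpose i j) R) ≡ π n q R
    π-transpose i j = π-relabel (Perm.transpose (inject≤ i n≤m) (inject≤ j n≤m)) (Perm.transpose i j)
                                (lowerLabel-transpose n≤m i j)

    π-combs-constant : ∀ {S S′} → IsLabelled n S → IsComb S → IsLabelled n S′ → IsComb S′ →
                       π n q S ≡ π n q S′
    π-combs-constant = comb-orbit (π n q) (π-resp-≅ n q) π-transpose

CombSupported : ∀ {n} → (Tree (Fin n) → ℚ) → Set
CombSupported {n} p = ∀ R → IsLabelled n R → ¬ IsComb R → p R ≡ 0ℚ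

combUniform⇒π-combSupported : ∀ {m} n (d : Dist m) → IsCombUniform d → CombSupported (π n d)
combUniform⇒π-combSupported n d (offComb≡0 , _) R _ ¬combR =
  trans (π≡πᵐ n d R) (expect-zero-on (All.tabulate term≡0))
  where
  term≡0 : ∀ {e} → e ∈ entries d → proj₂ e * 𝟙 (isoᵐ (restrict n (proj₁ e)) (just R)) ≡ 0ℚ
  term≡0 {t , w} e∈d with restrict n t | restrict-isComb n t
  ... | nothing | _ = ℚₚ.*-zeroʳ w
  ... | just R′ | comb⇒ with iso R′ R in R′≅R
  ...   | false = ℚₚ.*-zeroʳ w
  ...   | true  = trans (ℚₚ.*-identityʳ w) w≡0
    where
    ¬combt : ¬ IsComb t
    ¬combt combt with comb⇒ combt
    ... | just combR′ = ¬combR (≅-isComb (iso⇒≅ R′ R (T-≡ .from R′≅R)) combR′)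
    w≡0 : w ≡ 0ℚ
    w≡0 = expect-𝟙≡0⇒weight≡0 (λ u → iso u t) (nonneg d)
            (trans (sym (massL≡expect (entries d) t))
                   (offComb≡0 t (All.lookup (labelled d) e∈d) ¬combt))
            e∈d (iso-refl t)

module _ {m : ℕ} (n : ℕ) where

  agreement : Dist m → Dist m → ℚ
  agreement q₁ q₂ = expect (entries q₁) (λ t → πᵐ n q₂ (restrict n t))

  agreement-comm : ∀ q₁ q₂ → agreement q₁ q₂ ≡ agreement q₂ q₁
  agreement-comm q₁ q₂ = begin
    agreement q₁ q₂
      ≡⟨ expect-comm (entries q₁) (entries q₂) (λ t u → 𝟙 (isoᵐ (r u) (r t))) ⟩
    expect (entries q₂) (λ u → expect (entries q₁) (λ t → 𝟙 (isoᵐ (r u) (r t))))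
      ≡⟨ expect-cong (entries q₂) (λ u →
           expect-cong (entries q₁) (λ t → cong 𝟙 (isoᵐ-sym (r u) (r t)))) ⟩
    agreement q₂ q₁ ∎
    where
    r = restrict n

  module _ (1≤n : 1 ≤ n) (n≤m : n ≤ m) where

    agreement-combSupported : ∀ q₁ q₂ → CombSupported (π n q₁) → Exchangeable q₂ →
      ∀ {S} → IsLabelled n S → IsComb S → agreement q₁ q₂ ≡ π n q₂ S
    agreement-combSupported q₁ q₂ supp₁ ex₂ {S} labS combS = begin
      agreement q₁ q₂                      ≡⟨ expect-cong-on (All.tabulate term≡) ⟩
      expect (entries q₁) (λ _ → π n q₂ S) ≡⟨ expect-const (entries q₁) (π n q₂ S) ⟩
      sumW (entries q₁) * π n q₂ S         ≡⟨ cong (_* π n q₂ S) (total q₁) ⟩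
      1ℚ * π n q₂ S                        ≡⟨ ℚₚ.*-identityˡ (π n q₂ S) ⟩
      π n q₂ S                             ∎
      where
      term≡ : ∀ {e} → e ∈ entries q₁ →
              proj₂ e * πᵐ n q₂ (restrict n (proj₁ e)) ≡ proj₂ e * π n q₂ S
      term≡ {t , w} e∈q₁ with restrict-isLabelled 1≤n n≤m t (All.lookup (labelled q₁) e∈q₁)
      ... | R , rt≡R , labR with isComb? R
      ...   | yes combR rewrite rt≡R =
        cong (w *_) (trans (sym (π≡πᵐ n q₂ R)) (π-combs-constant q₂ ex₂ n≤m labR combR labS combS))
      ...   | no ¬combR rewrite π≡0⇒weight≡0 n q₁ e∈q₁ rt≡R (supp₁ R labR ¬combR) =
        trans (ℚₚ.*-zeroˡ (πᵐ n q₂ (restrict n t))) (sym (ℚₚ.*-zeroˡ (π n q₂ S)))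

    combSupported-π-unique : ∀ q₁ q₂ → Exchangeable q₁ → Exchangeable q₂ →
      CombSupported (π n q₁) → CombSupported (π n q₂) →
      ∀ S → IsLabelled n S → π n q₁ S ≡ π n q₂ S
    combSupported-π-unique q₁ q₂ ex₁ ex₂ supp₁ supp₂ S labS with isComb? S
    ... | yes combS = begin
      π n q₁ S        ≡⟨ agreement-combSupported q₂ q₁ supp₂ ex₁ labS combS ⟨
      agreement q₂ q₁ ≡⟨ agreement-comm q₂ q₁ ⟩
      agreement q₁ q₂ ≡⟨ agreement-combSupported q₁ q₂ supp₁ ex₂ labS combS ⟩
      π n q₂ S        ∎
    ... | no ¬combS = trans (supp₁ S labS ¬combS) (sym (supp₂ S labS ¬combS))

-- The comb vertex

convex-combination≡0ˡ : ∀ {l a b} → 0ℚ ℚ.< l → l ℚ.< 1ℚ → 0ℚ ℚ.≤ a → 0ℚ ℚ.≤ b →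
  l * a + (1ℚ - l) * b ≡ 0ℚ → a ≡ 0ℚ
convex-combination≡0ˡ {l} {a} {b} 0<l l<1 0≤a 0≤b sum≡0 = ℚₚ.≤-antisym a≤0 0≤a
  where
  0≤1-l : 0ℚ ℚ.≤ 1ℚ - l
  0≤1-l = ℚₚ.<⇒≤ (subst (ℚ._< 1ℚ - l) (ℚₚ.+-inverseʳ l) (ℚₚ.+-monoˡ-< (- l) l<1))
  la≡0 : l * a ≡ 0ℚ
  la≡0 = +≡0⇒≡0ˡ (0≤* (ℚₚ.<⇒≤ 0<l) 0≤a) (0≤* 0≤1-l 0≤b) sum≡0
  a≤0 : a ℚ.≤ 0ℚ
  a≤0 = ℚₚ.*-cancelˡ-≤-pos l {{positive 0<l}} (ℚₚ.≤-reflexive (trans la≡0 (sym (ℚₚ.*-zeroʳ l))))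

inEX-nonNeg : ∀ {n m x} → InEX n m x → ∀ R → IsLabelled n R → 0ℚ ℚ.≤ x R
inEX-nonNeg {n} (q , _ , x≡π) R labR = subst (0ℚ ℚ.≤_) (sym (x≡π R labR)) (π-nonNeg n q R)

combSupported-summandˡ : ∀ {n m} {v x y : Tree (Fin n) → ℚ} {l} → InEX n m x → InEX n m y →
  0ℚ ℚ.< l → l ℚ.< 1ℚ → (∀ R → IsLabelled n R → v R ≡ l * x R + (1ℚ - l) * y R) →
  CombSupported v → CombSupported x
combSupported-summandˡ x∈ y∈ 0<l l<1 v≡ supp R labR ¬combR =
  convex-combination≡0ˡ 0<l l<1 (inEX-nonNeg x∈ R labR) (inEX-nonNeg y∈ R labR)
    (trans (sym (v≡ R labR)) (supp R labR ¬combR))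

combSupported⇒isVertexEX : ∀ {n m} → 1 ≤ n → n ≤ m → (d : Dist m) → Exchangeable d →
  CombSupported (π n d) → IsVertexEX n m (π n d)
combSupported⇒isVertexEX {n} 1≤n n≤m d ex-d supp-d = (d , ex-d , λ _ _ → refl) , λ where
  x y l x∈@(q , ex-q , x≡π) y∈ 0<l l<1 v≡ S labS →
    let supp-q : CombSupported (π n q)
        supp-q R labR ¬combR = trans (sym (x≡π R labR))
          (combSupported-summandˡ x∈ y∈ 0<l l<1 v≡ supp-d R labR ¬combR)
    in trans (x≡π S labS) (combSupported-π-unique n 1≤n n≤m q d ex-q ex-d supp-q supp-d S labS)

lemma2p10 : (m n : ℕ) → 2 ≤ n → n ≤ m → (d : Dist m) → IsCombUniform d →
    IsVertexEX n m (π n d)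
lemma2p10 m n 2≤n n≤m d uniform =
  combSupported⇒isVertexEX (ℕₚ.<⇒≤ 2≤n) n≤m d
    (combUniform⇒exchangeable d uniform) (combUniform⇒π-combSupported n d uniform)
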